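{- Let $q=2^s$, let $i,e\in\mathbb F_2$ and let $\lambda\in\mathbb F_{q^2}^*$. Then $$|\mathbf T_e\cap\mathbf S_i\lambda|=\begin{cases}\delta_{e,0}\,q/2,&\text{if }\lambda\in\mathbf G_0\setminus\{0\},\\ \delta_{e,i}\,q/2,&\text{if }\lambda\in\mathbf G_1,\\ q/4,&\text{if }\lambda\in\mathbf G_r\text{ with }r\in\mathbb F_{q^2}\setminus\{0,1\}.\end{cases}$$
   Context: - $\mathbf T_e$ is the set of elements of $\mathbb F_{q^2}$ of absolute trace $e$. - $\mathbf S_0$ is the set of elements of $\mathbb F_q$ of absolute trace $0$, and $\mathbf S_1=\mathbb F_q\setminus\mathbf S_0$. - $\mathbf S_i\lambda=\{s\lambda:s\in\mathbf S_i\}$. - For $r\in\mathbb F_{q^2}$, $\mathbf G_r=\{x\in\mathbb F_{q^2}:x^q+x=r\}$. - $\delta$ is the Kronecker delta. -}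

module Defs where

open import Data.Nat using (ℕ; zero; suc; _^_)
open import Data.Bool using (Bool; true; false)
open import Data.List using (List; length; filter)
open import Data.List.Membership.Propositional using (_∈_)
open import Data.List.Relation.Unary.Unique.Propositional using (Unique)
open import Data.List.Relation.Unary.Any using (Any; any?)
open import Data.Product using (_×_; ∃)
open import Relation.Nullary using (¬_; Dec; yes; no)
open import Relation.Nullary.Decidable using (_×-dec_; ¬?)
open import Relation.Binary.PropositionalEquality using (_≡_; _≢_)
open import Relation.Binary.Definitions using (DecidableEquality)
open import Algebra.Structures using (IsCommutativeRing)

record FiniteField : Set₁ where
  infixl 7 _*_
  infixl 6 _+_
  field
    Carrier : Set
    _+_ _*_ : Carrier → Carrier → Carrier
    -_ : Carrier → Carrier
    0# 1# : Carrier
    isCommutativeRing : IsCommutativeRing _≡_ _+_ _*_ -_ 0# 1#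
    0≢1 : 0# ≢ 1#
    inverse : ∀ x → x ≢ 0# → ∃ λ y → x * y ≡ 1#
    _≟_ : DecidableEquality Carrier
    elements : List Carrier
    complete : ∀ x → x ∈ elements
    unique : Unique elements

  card : ℕ
  card = length elements

  pow : Carrier → ℕ → Carrier
  pow x zero = 1#
  pow x (suc n) = x * pow x n

  traceSum : ℕ → Carrier → Carrier
  traceSum zero x = 0#
  traceSum (suc k) x = traceSum k x + pow x (2 ^ k)

  embed : Bool → Carrier
  embed false = 0#
  embed true = 1#

δ : Bool → Bool → ℕ
δ false false = 1
δ true true = 1
δ _ _ = 0

module _ (F : FiniteField) (s : ℕ) where
  open FiniteField F

  -- q = 2^s; the field F is F_{q^2} (its cardinality will be q*q)
  q : ℕ
  q = 2 ^ s

  TrQ2 : Carrier → Carrier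
  TrQ2 = traceSum (2 Data.Nat.* s)

  TrQ : Carrier → Carrier
  TrQ = traceSum s

  InT : Bool → Carrier → Set
  InT e x = TrQ2 x ≡ embed e

  InFq : Carrier → Set
  InFq x = pow x q ≡ x

  InS : Bool → Carrier → Set
  InS false x = InFq x × TrQ x ≡ 0#
  InS true x = InFq x × ¬ (TrQ x ≡ 0#)

  InS? : ∀ i x → Dec (InS i x)
  InS? false x = (pow x q ≟ x) ×-dec (TrQ x ≟ 0#)
  InS? true x = (pow x q ≟ x) ×-dec ¬? (TrQ x ≟ 0#)

  InSλ : Bool → Carrier → Carrier → Set
  InSλ i lam y = Any (λ t → InS i t × y ≡ t * lam) elements

  InG : Carrier → Carrier → Set
  InG r x = pow x q + x ≡ r

  countTS : Bool → Bool → Carrier → ℕ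
  countTS e i lam =
    length (filter (λ y → (TrQ2 y ≟ embed e)
                          ×-dec any? (λ t → InS? i t ×-dec (y ≟ (t * lam))) elements)
                   elements)

-- Let K = 𝔽_q inside F = 𝔽_{q²}, let T be the absolute trace of K and r = λ^q + λ ∈ K. For t ∈ K the
-- absolute trace of tλ is T (t r), so y ↦ y/λ identifies T_e ∩ S_i λ with the class (i, e) of the
-- additive map t ↦ (T t, T (t r)) from K to 𝔽₂². Its nonempty fibres are translates of each other,
-- hence of equal size; they are indexed by the pairs (a, 0) when r = 0, by the diagonal when
-- r = 1, and by all of 𝔽₂² otherwise, which gives q/2, q/2 and q/4. Along the way: F has
-- characteristic 2 because |F| is even, |K| = q by counting roots of x^q + x and injecting F into
-- K × K, and T is onto 𝔽₂ since it is a polynomial of degree q/2 < |K|.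

module Submission where

open import Defs
open import Data.Nat using (ℕ; zero; suc; pred; _+_; _*_; _^_; _/_; _≤_; _<_; z≤n; s≤s; NonZero)
import Data.Nat.Properties as ℕ
open import Data.Nat.DivMod using (m*n/n≡m)
open import Data.Nat.Tactic.RingSolver using (solve-∀)
open import Data.Bool using (Bool; true; false; not; _xor_)
open import Data.Bool.Properties using (xor-same)
open import Data.Product using (_×_; _,_; proj₁; proj₂; ∃; ∃-syntax)
open import Data.Product.Properties using (≡-dec)
open import Data.Sum using (_⊎_; inj₁; inj₂)
open import Data.Empty using (⊥; ⊥-elim)
open import Data.List using (List; []; _∷_; _++_; length; filter; map; foldr; cartesianProduct)
open import Data.List.Properties using (length-filter; length-map; length-++; filter-none)
open import Data.List.Membership.Propositional using (_∈_)
open import Data.List.Membership.Propositional.Properties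
  using (∈-filter⁺; ∈-filter⁻; ∈-map⁺; ∈-map⁻; ∈-cartesianProduct⁺)
open import Data.List.Membership.Propositional.Properties.WithK using (unique∧set⇒bag)
import Data.List.Membership.DecPropositional as DecMembership
open import Data.List.Relation.Binary.Subset.Propositional using (_⊆_)
open import Data.List.Relation.Binary.BagAndSetEquality using (∼bag⇒↭)
open import Data.List.Relation.Binary.Permutation.Propositional using (_↭_; ↭⇒↭ₛ)
open import Data.List.Relation.Binary.Permutation.Propositional.Properties using (↭-length)
import Data.List.Relation.Binary.Permutation.Setoid.Properties as SetoidPermutation
open import Data.List.Relation.Unary.All as All using (All)
import Data.List.Relation.Unary.AllPairs as AllPairs
open import Data.List.Relation.Unary.Any as Any using (Any; here; there; any?)
open import Data.List.Relation.Unary.Unique.Propositional using (Unique; _∷_)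
import Data.List.Relation.Unary.Unique.Propositional.Properties as Unique
open import Function.Bundles using (mk⇔)
open import Relation.Nullary using (¬_; yes; no)
open import Relation.Nullary.Decidable using (¬?; _×-dec_)
open import Level using (0ℓ)
open import Relation.Unary using (Pred; Decidable; _∩_)
open import Relation.Unary.Properties using (_∩?_)
open import Relation.Binary.Definitions using (DecidableEquality)
open import Relation.Binary.PropositionalEquality
open import Algebra.Bundles using (CommutativeRing; CommutativeSemiring)
open import Algebra.Structures using (IsCommutativeRing)

module _ {A : Set} where

  Unique-∼set⇒↭ : ∀ {xs ys : List A} → Unique xs → Unique ys → xs ⊆ ys → ys ⊆ xs → xs ↭ ys
  Unique-∼set⇒↭ uxs uys xs⊆ys ys⊆xs = ∼bag⇒↭ (unique∧set⇒bag uxs uys (mk⇔ xs⊆ys ys⊆xs))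

  module _ (_≟_ : DecidableEquality A) where
    open DecMembership _≟_ using (_∈?_)

    Unique-⊆⇒length≤ : ∀ {xs ys : List A} → Unique xs → Unique ys → xs ⊆ ys → length xs ≤ length ys
    Unique-⊆⇒length≤ {xs} {ys} uxs uys xs⊆ys =
      subst (_≤ length ys) (↭-length xs∩ys↭xs) (length-filter (_∈? xs) ys)
      where
      xs∩ys↭xs : filter (_∈? xs) ys ↭ xs
      xs∩ys↭xs = Unique-∼set⇒↭ (Unique.filter⁺ (_∈? xs) {xs = ys} uys) uxs
        (λ p → proj₂ (∈-filter⁻ (_∈? xs) {xs = ys} p)) (λ p → ∈-filter⁺ (_∈? xs) (xs⊆ys p) p)

length-cartesianProduct : ∀ {A B : Set} (xs : List A) (ys : List B) →
                          length (cartesianProduct xs ys) ≡ length xs * length ys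
length-cartesianProduct [] ys = refl
length-cartesianProduct (x ∷ xs) ys = begin
  length (map (x ,_) ys ++ cartesianProduct xs ys)
    ≡⟨ length-++ (map (x ,_) ys) ⟩
  length (map (x ,_) ys) + length (cartesianProduct xs ys)
    ≡⟨ cong₂ _+_ (length-map (x ,_) ys) (length-cartesianProduct xs ys) ⟩
  length ys + length xs * length ys
    ∎
  where open ≡-Reasoning

module Counting {A : Set} (_≟_ : DecidableEquality A)
                (elements : List A) (unique : Unique elements) (complete : ∀ x → x ∈ elements) where

  count : {P : Pred A 0ℓ} → Decidable P → ℕ
  count P? = length (filter P? elements)

  count-≤-injection : ∀ {P Q : Pred A 0ℓ} (P? : Decidable P) (Q? : Decidable Q) (f : A → A) →
                      (∀ {x y} → f x ≡ f y → x ≡ y) → (∀ {x} → P x → Q (f x)) → count P? ≤ count Q?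
  count-≤-injection P? Q? f f-injective P⇒Q =
    subst (_≤ count Q?) (length-map f (filter P? elements))
      (Unique-⊆⇒length≤ _≟_ (Unique.map⁺ f-injective (Unique.filter⁺ P? {xs = elements} unique))
                             (Unique.filter⁺ Q? {xs = elements} unique) image⊆Q)
    where
    image⊆Q : map f (filter P? elements) ⊆ filter Q? elements
    image⊆Q p with ∈-map⁻ f p
    ... | x , x∈P , refl = ∈-filter⁺ Q? (complete (f x)) (P⇒Q (proj₂ (∈-filter⁻ P? {xs = elements} x∈P)))

  count-≡-bijection : ∀ {P Q : Pred A 0ℓ} (P? : Decidable P) (Q? : Decidable Q) (f g : A → A) →
                      (∀ x → g (f x) ≡ x) → (∀ y → f (g y) ≡ y) →
                      (∀ {x} → P x → Q (f x)) → (∀ {y} → Q y → P (g y)) → count P? ≡ count Q?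
  count-≡-bijection P? Q? f g gf≗id fg≗id P⇒Q Q⇒P = ℕ.≤-antisym
    (count-≤-injection P? Q? f (λ {x} {y} e → trans (sym (gf≗id x)) (trans (cong g e) (gf≗id y))) P⇒Q)
    (count-≤-injection Q? P? g (λ {x} {y} e → trans (sym (fg≗id x)) (trans (cong f e) (fg≗id y))) Q⇒P)

  count-cong : ∀ {P Q : Pred A 0ℓ} (P? : Decidable P) (Q? : Decidable Q) →
               (∀ {x} → P x → Q x) → (∀ {x} → Q x → P x) → count P? ≡ count Q?
  count-cong P? Q? = count-≡-bijection P? Q? (λ x → x) (λ x → x) (λ _ → refl) (λ _ → refl)

  count-≡0 : ∀ {P : Pred A 0ℓ} (P? : Decidable P) → (∀ x → ¬ P x) → count P? ≡ 0
  count-≡0 P? ¬P = cong length (filter-none P? {xs = elements} (All.tabulate (λ {x} _ → ¬P x)))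

  count-partition : ∀ {P Q R : Pred A 0ℓ} (P? : Decidable P) (Q? : Decidable Q) (R? : Decidable R) →
                    (∀ {x} → P x → Q x ⊎ R x) → (∀ {x} → Q x → R x → ⊥) →
                    count P? ≡ count (P? ∩? Q?) + count (P? ∩? R?)
  count-partition P? Q? R? cover disjoint = go elements
    where
    go : ∀ xs → length (filter P? xs) ≡ length (filter (P? ∩? Q?) xs) + length (filter (P? ∩? R?) xs)
    go [] = refl
    go (x ∷ xs) with P? x | Q? x | R? x
    ... | no _  | _     | _     = go xs
    ... | yes _ | yes q | yes r = ⊥-elim (disjoint q r)
    ... | yes _ | yes _ | no _  = cong suc (go xs)
    ... | yes _ | no _  | yes _ = trans (cong suc (go xs)) (sym (ℕ.+-suc _ _))
    ... | yes p | no ¬q | no ¬r with cover p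
    ...   | inj₁ q = ⊥-elim (¬q q)
    ...   | inj₂ r = ⊥-elim (¬r r)

xor≡true⇒≡not : ∀ {a b} → a xor b ≡ true → a ≡ not b
xor≡true⇒≡not {false} {true} _ = refl
xor≡true⇒≡not {true} {false} _ = refl

-- R is a subgroup of 𝔽₂² contained in none of the lines a = 0, b = 0, a = b, the only proper nonzero subgroups.
xor-closed-full : (R : Bool → Bool → Set) → (∀ {a b a' b'} → R a b → R a' b' → R (a xor a') (b xor b')) →
                  ∃[ b ] R true b → ∃[ a ] R a true → ∃[ a ] R a (not a) → ∀ a b → R a b
xor-closed-full R _⊕ᴿ_ on-a≡1 on-b≡1 on-a≢b = full (R10×R01 on-a≡1 on-b≡1 on-a≢b)
  where
  R10×R01 : ∃[ b ] R true b → ∃[ a ] R a true → ∃[ a ] R a (not a) → R true false × R false true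
  R10×R01 _             (false , R01) (true , R10)  = R10 , R01
  R10×R01 _             (true , R11)  (true , R10)  = R10 , (R10 ⊕ᴿ R11)
  R10×R01 (false , R10) _             (false , R01) = R10 , R01
  R10×R01 (true , R11)  _             (false , R01) = (R11 ⊕ᴿ R01) , R01
  full : R true false × R false true → ∀ a b → R a b
  full (R10 , _)   false false = R10 ⊕ᴿ R10
  full (R10 , _)   true  false = R10
  full (_   , R01) false true  = R01
  full (R10 , R01) true  true  = R10 ⊕ᴿ R01

n+n≡m⇒n≡m/2 : ∀ {n m} → n + n ≡ m → n ≡ m / 2
n+n≡m⇒n≡m/2 {n} refl = sym (trans (cong (_/ 2) (double n)) (m*n/n≡m n 2))
  where
  double : ∀ n → n + n ≡ n * 2
  double = solve-∀

[n+n]+[n+n]≡m⇒n≡m/4 : ∀ {n m} → (n + n) + (n + n) ≡ m → n ≡ m / 4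
[n+n]+[n+n]≡m⇒n≡m/4 {n} refl = sym (trans (cong (_/ 4) (quadruple n)) (m*n/n≡m n 4))
  where
  quadruple : ∀ n → (n + n) + (n + n) ≡ n * 4
  quadruple = solve-∀

module FieldProperties (F : FiniteField) where
  open FiniteField F renaming (_+_ to _⊕_; _*_ to _·_)
  open IsCommutativeRing isCommutativeRing
    using (*-comm; *-assoc; *-identityˡ; *-identityʳ; zeroˡ; zeroʳ; -‿inverseʳ; *-isCommutativeMonoid)

  commutativeRing : CommutativeRing _ _
  commutativeRing = record { isCommutativeRing = isCommutativeRing }

  open CommutativeRing commutativeRing using (commutativeSemiring; ring)
  open import Algebra.Properties.Semiring.Exp (CommutativeSemiring.semiring commutativeSemiring)
    using (^-assocʳ) renaming (_^_ to _^ᶠ_)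
  open import Algebra.Properties.CommutativeSemiring.Exp commutativeSemiring using (^-distrib-*)
  open import Algebra.Properties.Ring ring using (-‿distribˡ-*; -‿involutive)

  *-cancelˡ : ∀ {a x y} → a ≢ 0# → a · x ≡ a · y → x ≡ y
  *-cancelˡ {a} {x} {y} a≢0 ax≡ay with inverse a a≢0
  ... | b , ab≡1 = begin
    x             ≡⟨ sym (*-identityˡ x) ⟩
    1# · x        ≡⟨ cong (_· x) (trans (sym ab≡1) (*-comm a b)) ⟩
    (b · a) · x   ≡⟨ *-assoc b a x ⟩
    b · (a · x)   ≡⟨ cong (b ·_) ax≡ay ⟩
    b · (a · y)   ≡⟨ sym (*-assoc b a y) ⟩
    (b · a) · y   ≡⟨ cong (_· y) (trans (*-comm b a) ab≡1) ⟩
    1# · y        ≡⟨ *-identityˡ y ⟩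
    y             ∎
    where open ≡-Reasoning

  *-cancelʳ : ∀ {a x y} → a ≢ 0# → x · a ≡ y · a → x ≡ y
  *-cancelʳ {a} {x} {y} a≢0 xa≡ya = *-cancelˡ a≢0 (trans (*-comm a x) (trans xa≡ya (*-comm y a)))

  x*y≡0⇒y≡0 : ∀ {x y} → x ≢ 0# → x · y ≡ 0# → y ≡ 0#
  x*y≡0⇒y≡0 {x} x≢0 xy≡0 = *-cancelˡ x≢0 (trans xy≡0 (sym (zeroʳ x)))

  *-≢0 : ∀ {x y} → x ≢ 0# → y ≢ 0# → x · y ≢ 0#
  *-≢0 x≢0 y≢0 xy≡0 = y≢0 (x*y≡0⇒y≡0 x≢0 xy≡0)

  x*y≡1⇒y≢0 : ∀ {x y} → x · y ≡ 1# → y ≢ 0#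
  x*y≡1⇒y≢0 {x} xy≡1 refl = 0≢1 (trans (sym (zeroʳ x)) xy≡1)

  pow≡^ : ∀ x n → pow x n ≡ x ^ᶠ n
  pow≡^ x zero = refl
  pow≡^ x (suc n) = cong (x ·_) (pow≡^ x n)

  pow-* : ∀ x m n → pow x (m * n) ≡ pow (pow x m) n
  pow-* x m n rewrite pow≡^ x (m * n) | pow≡^ (pow x m) n | pow≡^ x m = sym (^-assocʳ x m n)

  pow-distrib-* : ∀ x y n → pow (x · y) n ≡ pow x n · pow y n
  pow-distrib-* x y n rewrite pow≡^ (x · y) n | pow≡^ x n | pow≡^ y n = ^-distrib-* x y n

  pow-1# : ∀ n → pow 1# n ≡ 1#
  pow-1# zero = refl
  pow-1# (suc n) = trans (cong (1# ·_) (pow-1# n)) (*-identityˡ 1#)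

  pow-0# : ∀ n .{{_ : NonZero n}} → pow 0# n ≡ 0#
  pow-0# (suc n) = zeroˡ (pow 0# n)

  product : List Carrier → Carrier
  product = foldr _·_ 1#

  product-↭ : ∀ {xs ys} → xs ↭ ys → product xs ≡ product ys
  product-↭ xs↭ys = SetoidPermutation.foldr-commMonoid (setoid Carrier) *-isCommutativeMonoid (↭⇒↭ₛ xs↭ys)

  product-map-* : ∀ a xs → product (map (a ·_) xs) ≡ pow a (length xs) · product xs
  product-map-* a [] = sym (*-identityˡ 1#)
  product-map-* a (x ∷ xs) = begin
    (a · x) · product (map (a ·_) xs)          ≡⟨ cong ((a · x) ·_) (product-map-* a xs) ⟩
    (a · x) · (pow a (length xs) · product xs) ≡⟨ swap-middle a x (pow a (length xs)) (product xs) ⟩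
    (a · pow a (length xs)) · (x · product xs) ∎
    where
    open ≡-Reasoning
    open import Algebra.Solver.Ring.NaturalCoefficients.Default commutativeSemiring
    swap-middle : ∀ a b c d → (a · b) · (c · d) ≡ (a · c) · (b · d)
    swap-middle = solve 4 (λ a b c d → (a :* b) :* (c :* d) := (a :* c) :* (b :* d)) refl

  product-≢0 : ∀ {xs} → All (_≢ 0#) xs → product xs ≢ 0#
  product-≢0 All.[] 1≡0 = 0≢1 (sym 1≡0)
  product-≢0 (x≢0 All.∷ xs≢0) = *-≢0 x≢0 (product-≢0 xs≢0)

  2≤card : 2 ≤ card
  2≤card = Unique-⊆⇒length≤ _≟_ {0# ∷ 1# ∷ []} ((0≢1 All.∷ All.[]) ∷ All.[] ∷ AllPairs.[]) unique
                            (λ _ → complete _)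

  nonzero : List Carrier
  nonzero = filter (λ x → ¬? (x ≟ 0#)) elements

  ∈-nonzero⁻ : ∀ {x} → x ∈ nonzero → x ≢ 0#
  ∈-nonzero⁻ p = proj₂ (∈-filter⁻ (λ x → ¬? (x ≟ 0#)) {xs = elements} p)

  ∈-nonzero⁺ : ∀ {x} → x ≢ 0# → x ∈ nonzero
  ∈-nonzero⁺ {x} x≢0 = ∈-filter⁺ (λ x → ¬? (x ≟ 0#)) (complete x) x≢0

  Unique-nonzero : Unique nonzero
  Unique-nonzero = Unique.filter⁺ (λ x → ¬? (x ≟ 0#)) {xs = elements} unique

  card≡1+|nonzero| : card ≡ suc (length nonzero)
  card≡1+|nonzero| = ↭-length (Unique-∼set⇒↭ unique unique-0∷nonzero (λ _ → 0-or-nonzero) (λ _ → complete _))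
    where
    unique-0∷nonzero : Unique (0# ∷ nonzero)
    unique-0∷nonzero = All.tabulate (λ p 0≡x → ∈-nonzero⁻ p (sym 0≡x)) ∷ Unique-nonzero
    0-or-nonzero : ∀ {x} → x ∈ 0# ∷ nonzero
    0-or-nonzero {x} with x ≟ 0#
    ... | yes refl = here refl
    ... | no x≢0 = there (∈-nonzero⁺ x≢0)

  -- Multiplication by a ≢ 0 permutes the nonzero elements, so it fixes their product.
  pow-|nonzero|≡1 : ∀ {a} → a ≢ 0# → pow a (length nonzero) ≡ 1#
  pow-|nonzero|≡1 {a} a≢0 = *-cancelʳ (product-≢0 (All.tabulate ∈-nonzero⁻)) (begin
    pow a (length nonzero) · product nonzero ≡⟨ sym (product-map-* a nonzero) ⟩
    product (map (a ·_) nonzero)             ≡⟨ product-↭ a*nonzero↭nonzero ⟩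
    product nonzero                          ≡⟨ sym (*-identityˡ _) ⟩
    1# · product nonzero                     ∎)
    where
    open ≡-Reasoning
    a*-preimage : ∀ {z} → z ∈ map (a ·_) nonzero → z ∈ nonzero
    a*-preimage p with ∈-map⁻ (a ·_) p
    ... | x , x∈ , refl = ∈-nonzero⁺ (*-≢0 a≢0 (∈-nonzero⁻ x∈))
    a*-image : ∀ {z} → z ∈ nonzero → z ∈ map (a ·_) nonzero
    a*-image {z} z∈ with inverse a a≢0
    ... | b , ab≡1 = subst (_∈ map (a ·_) nonzero) a*bz≡z (∈-map⁺ (a ·_) (∈-nonzero⁺ bz≢0))
      where
      a*bz≡z : a · (b · z) ≡ z
      a*bz≡z = trans (sym (*-assoc a b z)) (trans (cong (_· z) ab≡1) (*-identityˡ z))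
      bz≢0 : b · z ≢ 0#
      bz≢0 bz≡0 = ∈-nonzero⁻ z∈ (trans (sym a*bz≡z) (trans (cong (a ·_) bz≡0) (zeroʳ a)))
    a*nonzero↭nonzero : map (a ·_) nonzero ↭ nonzero
    a*nonzero↭nonzero = Unique-∼set⇒↭ (Unique.map⁺ (*-cancelˡ a≢0) Unique-nonzero) Unique-nonzero
      a*-preimage a*-image

  fermat : ∀ x → pow x card ≡ x
  fermat x rewrite card≡1+|nonzero| with x ≟ 0#
  ... | yes refl = zeroˡ _
  ... | no x≢0 = trans (cong (x ·_) (pow-|nonzero|≡1 x≢0)) (*-identityʳ x)

  even-card⇒char2 : ∀ m → card ≡ 2 * m → 1# ⊕ 1# ≡ 0#
  even-card⇒char2 m card≡2m = trans (cong (1# ⊕_) (sym -1≡1)) (-‿inverseʳ 1#)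
    where
    [-1]²≡1 : pow (- 1#) 2 ≡ 1#
    [-1]²≡1 = begin
      - 1# · (- 1# · 1#) ≡⟨ cong (- 1# ·_) (*-identityʳ (- 1#)) ⟩
      - 1# · - 1#        ≡⟨ sym (-‿distribˡ-* 1# (- 1#)) ⟩
      - (1# · - 1#)      ≡⟨ cong -_ (*-identityˡ (- 1#)) ⟩
      - - 1#             ≡⟨ -‿involutive 1# ⟩
      1#                 ∎
      where open ≡-Reasoning
    -1≡1 : - 1# ≡ 1#
    -1≡1 = begin
      - 1#                 ≡⟨ sym (fermat (- 1#)) ⟩
      pow (- 1#) card      ≡⟨ cong (pow (- 1#)) card≡2m ⟩
      pow (- 1#) (2 * m)   ≡⟨ pow-* (- 1#) 2 m ⟩
      pow (pow (- 1#) 2) m ≡⟨ cong (λ y → pow y m) [-1]²≡1 ⟩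
      pow 1# m             ≡⟨ pow-1# m ⟩
      1#                   ∎
      where open ≡-Reasoning

  idempotent⇒embed : ∀ {x} → pow x 2 ≡ x → ∃[ b ] x ≡ embed b
  idempotent⇒embed {x} x²≡x with x ≟ 0#
  ... | yes x≡0 = false , x≡0
  ... | no x≢0 = true , *-cancelˡ x≢0 (trans (sym (cong (x ·_) (*-identityʳ x))) (trans x²≡x (sym (*-identityʳ x))))

  embed-injective : ∀ {a b} → embed a ≡ embed b → a ≡ b
  embed-injective {false} {false} _ = refl
  embed-injective {false} {true} 0≡1 = ⊥-elim (0≢1 0≡1)
  embed-injective {true} {false} 1≡0 = ⊥-elim (0≢1 (sym 1≡0))
  embed-injective {true} {true} _ = refl

module Characteristic2 (F : FiniteField)
                       (char2 : FiniteField._+_ F (FiniteField.1# F) (FiniteField.1# F) ≡ FiniteField.0# F) where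
  open FiniteField F renaming (_+_ to _⊕_; _*_ to _·_)
  open FieldProperties F
  open IsCommutativeRing isCommutativeRing
    using (*-comm; +-comm; +-assoc; *-identityʳ; zeroʳ; +-identityˡ; +-identityʳ)
  open CommutativeRing commutativeRing using (commutativeSemiring; +-commutativeSemigroup)
  open import Algebra.Properties.CommutativeSemigroup +-commutativeSemigroup using (interchange)
  open import Algebra.Solver.Ring.NaturalCoefficients.Default commutativeSemiring
  open ≡-Reasoning

  x⊕x≡0 : ∀ x → x ⊕ x ≡ 0#
  x⊕x≡0 x = begin
    x ⊕ x          ≡⟨ solve 1 (λ x → x :+ x := x :* (con 1 :+ con 1)) refl x ⟩
    x · (1# ⊕ 1#)  ≡⟨ cong (x ·_) char2 ⟩
    x · 0#         ≡⟨ zeroʳ x ⟩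
    0#             ∎

  [x⊕y]⊕y≡x : ∀ x y → (x ⊕ y) ⊕ y ≡ x
  [x⊕y]⊕y≡x x y = trans (+-assoc x y y) (trans (cong (x ⊕_) (x⊕x≡0 y)) (+-identityʳ x))

  ⊕-cancelʳ : ∀ {x y z} → x ⊕ z ≡ y ⊕ z → x ≡ y
  ⊕-cancelʳ {x} {y} {z} eq = trans (sym ([x⊕y]⊕y≡x x z)) (trans (cong (_⊕ z) eq) ([x⊕y]⊕y≡x y z))

  x⊕y≡0⇒x≡y : ∀ {x y} → x ⊕ y ≡ 0# → x ≡ y
  x⊕y≡0⇒x≡y {y = y} eq = ⊕-cancelʳ (trans eq (sym (x⊕x≡0 y)))

  embed-xor : ∀ a b → embed a ⊕ embed b ≡ embed (a xor b)
  embed-xor false b = +-identityˡ (embed b)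
  embed-xor true false = +-identityʳ 1#
  embed-xor true true = char2

  square-⊕ : ∀ x y → pow (x ⊕ y) 2 ≡ pow x 2 ⊕ pow y 2
  square-⊕ x y = begin
    pow (x ⊕ y) 2                         ≡⟨ expand x y ⟩
    (pow x 2 ⊕ pow y 2) ⊕ (x · y ⊕ x · y) ≡⟨ cong ((pow x 2 ⊕ pow y 2) ⊕_) (x⊕x≡0 (x · y)) ⟩
    (pow x 2 ⊕ pow y 2) ⊕ 0#              ≡⟨ +-identityʳ _ ⟩
    pow x 2 ⊕ pow y 2                     ∎
    where
    expand : ∀ x y → pow (x ⊕ y) 2 ≡ (pow x 2 ⊕ pow y 2) ⊕ (x · y ⊕ x · y)
    expand = solve 2 (λ x y → (x :+ y) :* ((x :+ y) :* con 1) :=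
                               (x :* (x :* con 1) :+ y :* (y :* con 1)) :+ (x :* y :+ x :* y)) refl

  pow-2^-suc : ∀ x k → pow x (2 ^ suc k) ≡ pow (pow x 2) (2 ^ k)
  pow-2^-suc x k = pow-* x 2 (2 ^ k)

  frobenius : ∀ k x y → pow (x ⊕ y) (2 ^ k) ≡ pow x (2 ^ k) ⊕ pow y (2 ^ k)
  frobenius zero x y = trans (*-identityʳ (x ⊕ y)) (sym (cong₂ _⊕_ (*-identityʳ x) (*-identityʳ y)))
  frobenius (suc k) x y = begin
    pow (x ⊕ y) (2 ^ suc k)                       ≡⟨ pow-2^-suc (x ⊕ y) k ⟩
    pow (pow (x ⊕ y) 2) (2 ^ k)                   ≡⟨ cong (λ z → pow z (2 ^ k)) (square-⊕ x y) ⟩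
    pow (pow x 2 ⊕ pow y 2) (2 ^ k)               ≡⟨ frobenius k (pow x 2) (pow y 2) ⟩
    pow (pow x 2) (2 ^ k) ⊕ pow (pow y 2) (2 ^ k) ≡⟨ sym (cong₂ _⊕_ (pow-2^-suc x k) (pow-2^-suc y k)) ⟩
    pow x (2 ^ suc k) ⊕ pow y (2 ^ suc k)         ∎

  pow-0#-2^ : ∀ k → pow 0# (2 ^ k) ≡ 0#
  pow-0#-2^ k = pow-0# (2 ^ k) {{ℕ.m^n≢0 2 k}}

  traceSum-⊕ : ∀ k x y → traceSum k (x ⊕ y) ≡ traceSum k x ⊕ traceSum k y
  traceSum-⊕ zero x y = sym (+-identityˡ 0#)
  traceSum-⊕ (suc k) x y = begin
    traceSum k (x ⊕ y) ⊕ pow (x ⊕ y) (2 ^ k)                      ≡⟨ cong₂ _⊕_ (traceSum-⊕ k x y) (frobenius k x y) ⟩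
    (traceSum k x ⊕ traceSum k y) ⊕ (pow x (2 ^ k) ⊕ pow y (2 ^ k)) ≡⟨ interchange _ _ _ _ ⟩
    (traceSum k x ⊕ pow x (2 ^ k)) ⊕ (traceSum k y ⊕ pow y (2 ^ k)) ∎

  traceSum-0# : ∀ k → traceSum k 0# ≡ 0#
  traceSum-0# zero = refl
  traceSum-0# (suc k) = trans (cong₂ _⊕_ (traceSum-0# k) (pow-0#-2^ k)) (+-identityˡ 0#)

  traceSum-+ : ∀ a b x → traceSum (a + b) x ≡ traceSum a x ⊕ traceSum b (pow x (2 ^ a))
  traceSum-+ a zero x rewrite ℕ.+-identityʳ a = sym (+-identityʳ _)
  traceSum-+ a (suc b) x rewrite ℕ.+-suc a b = begin
    traceSum (a + b) x ⊕ pow x (2 ^ (a + b))                                ≡⟨ cong₂ _⊕_ (traceSum-+ a b x) pow-2^-+ ⟩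
    (traceSum a x ⊕ traceSum b (pow x (2 ^ a))) ⊕ pow (pow x (2 ^ a)) (2 ^ b) ≡⟨ +-assoc _ _ _ ⟩
    traceSum a x ⊕ (traceSum b (pow x (2 ^ a)) ⊕ pow (pow x (2 ^ a)) (2 ^ b)) ∎
    where
    pow-2^-+ : pow x (2 ^ (a + b)) ≡ pow (pow x (2 ^ a)) (2 ^ b)
    pow-2^-+ = trans (cong (pow x) (ℕ.^-distribˡ-+-* 2 a b)) (pow-* x (2 ^ a) (2 ^ b))

  traceSum-square : ∀ k x → pow (traceSum k x) 2 ≡ traceSum k (pow x 2)
  traceSum-square zero x = pow-0# 2
  traceSum-square (suc k) x = begin
    pow (traceSum k x ⊕ pow x (2 ^ k)) 2                 ≡⟨ square-⊕ _ _ ⟩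
    pow (traceSum k x) 2 ⊕ pow (pow x (2 ^ k)) 2         ≡⟨ cong₂ _⊕_ (traceSum-square k x) powers-commute ⟩
    traceSum k (pow x 2) ⊕ pow (pow x 2) (2 ^ k)         ∎
    where
    powers-commute : pow (pow x (2 ^ k)) 2 ≡ pow (pow x 2) (2 ^ k)
    powers-commute = trans (sym (pow-* x (2 ^ k) 2)) (trans (cong (pow x) (ℕ.*-comm (2 ^ k) 2)) (pow-* x 2 (2 ^ k)))

  traceSum-suc : ∀ k x → traceSum (suc k) x ≡ x ⊕ traceSum k (pow x 2)
  traceSum-suc k x = trans (traceSum-+ 1 k x) (cong (_⊕ traceSum k (pow x 2)) (trans (+-identityˡ _) (*-identityʳ x)))

  -- For a fixed point of x ↦ x^(2^k) the trace is idempotent.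
  traceSum-fixed-embed : ∀ k {x} → pow x (2 ^ k) ≡ x → ∃[ b ] traceSum k x ≡ embed b
  traceSum-fixed-embed k {x} fixed = idempotent⇒embed (trans (traceSum-square k x) (⊕-cancelʳ (begin
    traceSum k (pow x 2) ⊕ x     ≡⟨ +-comm _ x ⟩
    x ⊕ traceSum k (pow x 2)     ≡⟨ sym (traceSum-suc k x) ⟩
    traceSum k x ⊕ pow x (2 ^ k) ≡⟨ cong (traceSum k x ⊕_) fixed ⟩
    traceSum k x ⊕ x             ∎)))

  data Poly≤ : ℕ → (Carrier → Carrier) → Set where
    constant : ∀ {n f} c → (∀ x → f x ≡ c) → Poly≤ n f
    horner : ∀ {n f} c g → Poly≤ n g → (∀ x → f x ≡ c ⊕ x · g x) → Poly≤ (suc n) f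

  data Monic : ℕ → (Carrier → Carrier) → Set where
    one : ∀ {f} → (∀ x → f x ≡ 1#) → Monic 0 f
    horner : ∀ {n f} c g → Monic n g → (∀ x → f x ≡ c ⊕ x · g x) → Monic (suc n) f

  Poly≤-weaken : ∀ {m n f} → m ≤ n → Poly≤ m f → Poly≤ n f
  Poly≤-weaken _ (constant c f≗c) = constant c f≗c
  Poly≤-weaken (s≤s m≤n) (horner c g pg f≗) = horner c g (Poly≤-weaken m≤n pg) f≗

  Monic⇒Poly≤ : ∀ {n f} → Monic n f → Poly≤ n f
  Monic⇒Poly≤ (one f≗1) = constant 1# f≗1
  Monic⇒Poly≤ (horner c g mg f≗) = horner c g (Monic⇒Poly≤ mg) f≗

  Monic-cong : ∀ {n f g} → Monic n f → (∀ x → g x ≡ f x) → Monic n g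
  Monic-cong (one f≗1) g≗f = one (λ x → trans (g≗f x) (f≗1 x))
  Monic-cong (horner c h mh f≗) g≗f = horner c h mh (λ x → trans (g≗f x) (f≗ x))

  private
    regroup-constants : ∀ c x g d → (c ⊕ x · g) ⊕ d ≡ (c ⊕ d) ⊕ x · g
    regroup-constants = solve 4 (λ c x g d → (c :+ x :* g) :+ d := (c :+ d) :+ x :* g) refl
    regroup-sum : ∀ c x g d h → (c ⊕ x · g) ⊕ (d ⊕ x · h) ≡ (c ⊕ d) ⊕ x · (g ⊕ h)
    regroup-sum = solve 5 (λ c x g d h → (c :+ x :* g) :+ (d :+ x :* h) := (c :+ d) :+ x :* (g :+ h)) refl

  Poly≤-⊕ : ∀ {n f g} → Poly≤ n f → Poly≤ n g → Poly≤ n (λ x → f x ⊕ g x)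
  Poly≤-⊕ (constant c f≗) (constant d g≗) = constant (c ⊕ d) (λ x → cong₂ _⊕_ (f≗ x) (g≗ x))
  Poly≤-⊕ (constant c f≗) (horner d h ph g≗) =
    horner (c ⊕ d) h ph (λ x → trans (cong₂ _⊕_ (f≗ x) (g≗ x)) (sym (+-assoc c d (x · h x))))
  Poly≤-⊕ (horner c h ph f≗) (constant d g≗) =
    horner (c ⊕ d) h ph (λ x → trans (cong₂ _⊕_ (f≗ x) (g≗ x)) (regroup-constants c x (h x) d))
  Poly≤-⊕ (horner c h ph f≗) (horner d k pk g≗) =
    horner (c ⊕ d) (λ x → h x ⊕ k x) (Poly≤-⊕ ph pk)
           (λ x → trans (cong₂ _⊕_ (f≗ x) (g≗ x)) (regroup-sum c x (h x) d (k x)))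

  Poly≤-scale : ∀ {n f} a → Poly≤ n f → Poly≤ n (λ x → a · f x)
  Poly≤-scale a (constant c f≗) = constant (a · c) (λ x → cong (a ·_) (f≗ x))
  Poly≤-scale a (horner c g pg f≗) =
    horner (a · c) (λ x → a · g x) (Poly≤-scale a pg) (λ x → trans (cong (a ·_) (f≗ x)) (distribute a c x (g x)))
    where
    distribute : ∀ a c x g → a · (c ⊕ x · g) ≡ a · c ⊕ x · (a · g)
    distribute = solve 4 (λ a c x g → a :* (c :+ x :* g) := a :* c :+ x :* (a :* g)) refl

  Monic-⊕ : ∀ {m n f g} → Monic n f → Poly≤ m g → m < n → Monic n (λ x → f x ⊕ g x)
  Monic-⊕ (horner c h mh f≗) (constant d g≗) _ =
    horner (c ⊕ d) h mh (λ x → trans (cong₂ _⊕_ (f≗ x) (g≗ x)) (regroup-constants c x (h x) d))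
  Monic-⊕ (horner c h mh f≗) (horner d k pk g≗) (s≤s m<n) =
    horner (c ⊕ d) (λ x → h x ⊕ k x) (Monic-⊕ mh pk m<n)
           (λ x → trans (cong₂ _⊕_ (f≗ x) (g≗ x)) (regroup-sum c x (h x) d (k x)))

  Monic-pow : ∀ n → Monic n (λ x → pow x n)
  Monic-pow zero = one (λ _ → refl)
  Monic-pow (suc n) = horner 0# (λ x → pow x n) (Monic-pow n) (λ x → sym (+-identityˡ _))

  -- The Horner step of polynomial division by x ⊕ a; in characteristic 2 no subtraction is needed.
  horner-difference : ∀ c x a G G' H → G ⊕ G' ≡ (x ⊕ a) · H →
                      (c ⊕ x · G) ⊕ (c ⊕ a · G') ≡ (x ⊕ a) · (G ⊕ a · H)
  horner-difference c x a G G' H G⊕G'≡ = begin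
    (c ⊕ x · G) ⊕ (c ⊕ a · G')                                ≡⟨ sym (+-identityʳ _) ⟩
    ((c ⊕ x · G) ⊕ (c ⊕ a · G')) ⊕ 0#                         ≡⟨ cong (_ ⊕_) (sym (x⊕x≡0 (a · G))) ⟩
    ((c ⊕ x · G) ⊕ (c ⊕ a · G')) ⊕ (a · G ⊕ a · G)            ≡⟨ rearrange c x a G G' ⟩
    ((x ⊕ a) · G ⊕ a · (G ⊕ G')) ⊕ (c ⊕ c)                    ≡⟨ cong₂ (λ u v → ((x ⊕ a) · G ⊕ a · u) ⊕ v) G⊕G'≡ (x⊕x≡0 c) ⟩
    ((x ⊕ a) · G ⊕ a · ((x ⊕ a) · H)) ⊕ 0#                    ≡⟨ +-identityʳ _ ⟩
    (x ⊕ a) · G ⊕ a · ((x ⊕ a) · H)                           ≡⟨ factor-out x a G H ⟩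
    (x ⊕ a) · (G ⊕ a · H)                                     ∎
    where
    rearrange : ∀ c x a G G' →
                ((c ⊕ x · G) ⊕ (c ⊕ a · G')) ⊕ (a · G ⊕ a · G) ≡ ((x ⊕ a) · G ⊕ a · (G ⊕ G')) ⊕ (c ⊕ c)
    rearrange = solve 5 (λ c x a G G' → ((c :+ x :* G) :+ (c :+ a :* G')) :+ (a :* G :+ a :* G)
                                        := ((x :+ a) :* G :+ a :* (G :+ G')) :+ (c :+ c)) refl
    factor-out : ∀ x a G H → (x ⊕ a) · G ⊕ a · ((x ⊕ a) · H) ≡ (x ⊕ a) · (G ⊕ a · H)
    factor-out = solve 4 (λ x a G H → (x :+ a) :* G :+ a :* ((x :+ a) :* H) := (x :+ a) :* (G :+ a :* H)) refl

  Poly≤-root-factor : ∀ {n f} → Poly≤ n f → ∀ a →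
                      ∃[ h ] Poly≤ (pred n) h × (∀ x → f x ⊕ f a ≡ (x ⊕ a) · h x)
  Poly≤-root-factor (constant c f≗) a =
    (λ _ → 0#) , constant 0# (λ _ → refl) , (λ x → trans (cong₂ _⊕_ (f≗ x) (f≗ a)) (trans (x⊕x≡0 c) (sym (zeroʳ _))))
  Poly≤-root-factor {suc n} (horner c g pg f≗) a with Poly≤-root-factor pg a
  ... | h , ph , g-factor =
    (λ x → g x ⊕ a · h x) ,
    Poly≤-⊕ pg (Poly≤-scale a (Poly≤-weaken (ℕ.pred[n]≤n {n}) ph)) ,
    (λ x → trans (cong₂ _⊕_ (f≗ x) (f≗ a)) (horner-difference c x a (g x) (g a) (h x) (g-factor x)))

  Monic-root-factor : ∀ {n f} → Monic (suc n) f → ∀ a →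
                      ∃[ h ] Monic n h × (∀ x → f x ⊕ f a ≡ (x ⊕ a) · h x)
  Monic-root-factor {zero} (horner c g (one g≗1) f≗) a =
    (λ x → g x ⊕ a · 0#) ,
    one (λ x → trans (cong₂ _⊕_ (g≗1 x) (zeroʳ a)) (+-identityʳ 1#)) ,
    (λ x → trans (cong₂ _⊕_ (f≗ x) (f≗ a))
                 (horner-difference c x a (g x) (g a) 0# (trans (cong₂ _⊕_ (g≗1 x) (g≗1 a)) (trans char2 (sym (zeroʳ _))))))
  Monic-root-factor {suc n} (horner c g mg f≗) a with Poly≤-root-factor (Monic⇒Poly≤ mg) a
  ... | h , ph , g-factor =
    (λ x → g x ⊕ a · h x) ,
    Monic-⊕ mg (Poly≤-scale a ph) (ℕ.n<1+n n) ,
    (λ x → trans (cong₂ _⊕_ (f≗ x) (f≗ a)) (horner-difference c x a (g x) (g a) (h x) (g-factor x)))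

  Monic-roots≤degree : ∀ {d f} → Monic d f → ∀ {roots} → Unique roots → (∀ {x} → x ∈ roots → f x ≡ 0#) →
                       length roots ≤ d
  Monic-roots≤degree _ {[]} _ _ = z≤n
  Monic-roots≤degree (one f≗1) {a ∷ _} _ root = ⊥-elim (0≢1 (trans (sym (root (here refl))) (f≗1 a)))
  Monic-roots≤degree {suc d} {f} mf {a ∷ roots} (a∉roots ∷ unique-roots) root with Monic-root-factor mf a
  ... | h , mh , f-factor = s≤s (Monic-roots≤degree mh unique-roots root-of-h)
    where
    root-of-h : ∀ {x} → x ∈ roots → h x ≡ 0#
    root-of-h {x} x∈ = x*y≡0⇒y≡0 x⊕a≢0 (begin
      (x ⊕ a) · h x ≡⟨ sym (f-factor x) ⟩
      f x ⊕ f a     ≡⟨ cong₂ _⊕_ (root (there x∈)) (root (here refl)) ⟩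
      0# ⊕ 0#       ≡⟨ x⊕x≡0 0# ⟩
      0#            ∎)
      where
      x⊕a≢0 : x ⊕ a ≢ 0#
      x⊕a≢0 x⊕a≡0 = All.lookup a∉roots x∈ (sym (x⊕y≡0⇒x≡y x⊕a≡0))

  Monic-traceSum : ∀ k → Monic (2 ^ k) (traceSum (suc k))
  Monic-traceSum zero = Monic-cong (Monic-pow 1) (λ x → +-identityˡ (pow x 1))
  Monic-traceSum (suc k) =
    Monic-cong (Monic-⊕ (Monic-pow (2 ^ suc k)) (Monic⇒Poly≤ (Monic-traceSum k)) 2^k<2^[1+k]) (λ x → +-comm _ _)
    where
    2^k<2^[1+k] : 2 ^ k < 2 ^ suc k
    2^k<2^[1+k] = ℕ.^-monoʳ-< 2 (s≤s (s≤s z≤n)) (ℕ.n<1+n k)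

module SquareOrderField (F : FiniteField) (s' : ℕ)
                        (card≡q² : FiniteField.card F ≡ q F (suc s') * q F (suc s')) where
  open FiniteField F renaming (_+_ to _⊕_; _*_ to _·_)
  open FieldProperties F
  open IsCommutativeRing isCommutativeRing using (*-comm; *-assoc; +-comm; *-identityʳ; +-identityˡ; zeroʳ; distribˡ; distribʳ)
  open CommutativeRing commutativeRing using (+-commutativeSemigroup)
  open import Algebra.Properties.CommutativeSemigroup +-commutativeSemigroup using (interchange)
  open Counting _≟_ elements unique complete

  Q : ℕ
  Q = q F (suc s')

  char2 : 1# ⊕ 1# ≡ 0#
  char2 = even-card⇒char2 (2 ^ s' * Q) (trans card≡q² (ℕ.*-assoc 2 (2 ^ s') Q))

  open Characteristic2 F char2

  K : Pred Carrier 0ℓ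
  K = InFq F (suc s')

  K? : Decidable K
  K? x = pow x Q ≟ x

  K-⊕ : ∀ {x y} → K x → K y → K (x ⊕ y)
  K-⊕ {x} {y} x∈K y∈K = trans (frobenius (suc s') x y) (cong₂ _⊕_ x∈K y∈K)

  K-· : ∀ {x y} → K x → K y → K (x · y)
  K-· {x} {y} x∈K y∈K = trans (pow-distrib-* x y Q) (cong₂ _·_ x∈K y∈K)

  K-1# : K 1#
  K-1# = pow-1# Q

  K-inverse : ∀ {y z} → K y → y · z ≡ 1# → K z
  K-inverse {y} {z} y∈K yz≡1 = *-cancelˡ y≢0 (begin
    y · pow z Q       ≡⟨ cong (_· pow z Q) (sym y∈K) ⟩
    pow y Q · pow z Q ≡⟨ sym (pow-distrib-* y z Q) ⟩
    pow (y · z) Q     ≡⟨ trans (cong (λ w → pow w Q) yz≡1) K-1# ⟩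
    1#                ≡⟨ sym yz≡1 ⟩
    y · z             ∎)
    where
    open ≡-Reasoning
    y≢0 : y ≢ 0#
    y≢0 = x*y≡1⇒y≢0 (trans (*-comm z y) yz≡1)

  pow-Q-Q : ∀ x → pow (pow x Q) Q ≡ x
  pow-Q-Q x = trans (sym (pow-* x Q Q)) (trans (cong (pow x) (sym card≡q²)) (fermat x))

  relTrace : Carrier → Carrier
  relTrace x = pow x Q ⊕ x

  relTrace-⊕ : ∀ x y → relTrace (x ⊕ y) ≡ relTrace x ⊕ relTrace y
  relTrace-⊕ x y = trans (cong (_⊕ (x ⊕ y)) (frobenius (suc s') x y)) (interchange _ _ _ _)

  relTrace-K : ∀ x → K (relTrace x)
  relTrace-K x = trans (frobenius (suc s') (pow x Q) x) (trans (cong (_⊕ pow x Q) (pow-Q-Q x)) (+-comm x (pow x Q)))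

  relTrace≡0⇒K : ∀ {x} → relTrace x ≡ 0# → K x
  relTrace≡0⇒K = x⊕y≡0⇒x≡y

  K-elements : List Carrier
  K-elements = filter K? elements

  Unique-K-elements : Unique K-elements
  Unique-K-elements = Unique.filter⁺ K? {xs = elements} unique

  ∈-K-elements⁻ : ∀ {x} → x ∈ K-elements → K x
  ∈-K-elements⁻ p = proj₂ (∈-filter⁻ K? {xs = elements} p)

  |K|≤Q : count K? ≤ Q
  |K|≤Q = Monic-roots≤degree Monic-relTrace Unique-K-elements (λ p → trans (cong (_⊕ _) (∈-K-elements⁻ p)) (x⊕x≡0 _))
    where
    Monic-relTrace : Monic Q relTrace
    Monic-relTrace = Monic-⊕ (Monic-pow Q) (horner 0# (λ _ → 1#) (constant 1# (λ _ → refl))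
                                           (λ x → sym (trans (+-identityˡ _) (*-identityʳ x))))
                             (ℕ.^-monoʳ-< 2 (s≤s (s≤s z≤n)) {0} {suc s'} (s≤s z≤n))

  preimage : Carrier → Carrier
  preimage k with any? (λ y → relTrace y ≟ k) elements
  ... | yes found = proj₁ (Any.satisfied found)
  ... | no _ = 0#

  relTrace-preimage : ∀ x → relTrace (preimage (relTrace x)) ≡ relTrace x
  relTrace-preimage x with any? (λ y → relTrace y ≟ relTrace x) elements
  ... | yes found = proj₂ (Any.satisfied found)
  ... | no none = ⊥-elim (none (Any.map (λ { refl → refl }) (complete x)))

  -- The fibres of relTrace are cosets of its kernel K.
  card≤|K|² : card ≤ count K? * count K?
  card≤|K|² = subst₂ _≤_ (length-map split elements) (length-cartesianProduct K-elements K-elements)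
    (Unique-⊆⇒length≤ (≡-dec _≟_ _≟_) (Unique.map⁺ split-injective unique)
                      (Unique.cartesianProduct⁺ Unique-K-elements Unique-K-elements) image⊆K²)
    where
    split : Carrier → Carrier × Carrier
    split x = relTrace x , x ⊕ preimage (relTrace x)
    split-injective : ∀ {x y} → split x ≡ split y → x ≡ y
    split-injective {x} {y} eq =
      ⊕-cancelʳ (trans (cong proj₂ eq) (cong (λ k → y ⊕ preimage k) (sym (cong proj₁ eq))))
    image⊆K² : map split elements ⊆ cartesianProduct K-elements K-elements
    image⊆K² p with ∈-map⁻ split p
    ... | x , _ , refl = ∈-cartesianProduct⁺ (∈-filter⁺ K? (complete _) (relTrace-K x))
                                               (∈-filter⁺ K? (complete _) (relTrace≡0⇒K difference-in-kernel))
      where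
      difference-in-kernel : relTrace (x ⊕ preimage (relTrace x)) ≡ 0#
      difference-in-kernel = trans (relTrace-⊕ x _) (trans (cong (relTrace x ⊕_) (relTrace-preimage x)) (x⊕x≡0 _))

  |K|≡Q : count K? ≡ Q
  |K|≡Q = ℕ.≤-antisym |K|≤Q (ℕ.≮⇒≥ λ |K|<Q →
    ℕ.<⇒≱ (ℕ.*-mono-< |K|<Q |K|<Q) (subst (_≤ count K? * count K?) card≡q² card≤|K|²))

  T : Carrier → Carrier
  T = TrQ F (suc s')

  T-⊕ : ∀ x y → T (x ⊕ y) ≡ T x ⊕ T y
  T-⊕ = traceSum-⊕ (suc s')

  HasTrace : Bool → Pred Carrier 0ℓ
  HasTrace b x = T x ≡ embed b

  HasTrace? : ∀ b → Decidable (HasTrace b)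
  HasTrace? b x = T x ≟ embed b

  K⇒trace : ∀ {x} → K x → ∃[ b ] HasTrace b x
  K⇒trace = traceSum-fixed-embed (suc s')

  K⇒HasTrace : ∀ {x} → K x → HasTrace false x ⊎ HasTrace true x
  K⇒HasTrace x∈K with K⇒trace x∈K
  ... | false , T≡0 = inj₁ T≡0
  ... | true , T≡1 = inj₂ T≡1

  HasTrace-disjoint : ∀ {x} → HasTrace false x → HasTrace true x → ⊥
  HasTrace-disjoint T≡0 T≡1 = 0≢1 (trans (sym T≡0) T≡1)

  TrQ2≡T∘relTrace : ∀ x → TrQ2 F (suc s') x ≡ T (relTrace x)
  TrQ2≡T∘relTrace x rewrite ℕ.+-identityʳ (suc s') =
    trans (traceSum-+ (suc s') (suc s') x) (trans (+-comm _ _) (sym (T-⊕ (pow x Q) x)))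

  relTrace-K-· : ∀ {t} x → K t → relTrace (t · x) ≡ t · relTrace x
  relTrace-K-· {t} x t∈K = begin
    pow (t · x) Q ⊕ t · x     ≡⟨ cong (_⊕ t · x) (trans (pow-distrib-* t x Q) (cong (_· pow x Q) t∈K)) ⟩
    t · pow x Q ⊕ t · x       ≡⟨ sym (distribˡ t (pow x Q) x) ⟩
    t · (pow x Q ⊕ x)         ∎
    where open ≡-Reasoning

  InS⇒Class : ∀ i {t} → InS F (suc s') i t → (K ∩ HasTrace i) t
  InS⇒Class false t∈S = t∈S
  InS⇒Class true (t∈K , T≢0) with K⇒HasTrace t∈K
  ... | inj₁ T≡0 = ⊥-elim (T≢0 T≡0)
  ... | inj₂ T≡1 = t∈K , T≡1

  Class⇒InS : ∀ i {t} → (K ∩ HasTrace i) t → InS F (suc s') i t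
  Class⇒InS false t∈C = t∈C
  Class⇒InS true {t} (t∈K , T≡1) = t∈K , λ T≡0 → HasTrace-disjoint {t} T≡0 T≡1

  T-onto : ∃[ a ] K a × HasTrace true a
  T-onto with any? (K? ∩? HasTrace? true) elements
  ... | yes found = Any.satisfied found
  ... | no none = ⊥-elim (ℕ.<⇒≱ 2^s'<Q (subst (_≤ 2 ^ s') |K|≡Q
                   (Monic-roots≤degree (Monic-traceSum s') Unique-K-elements K⇒T≡0)))
    where
    2^s'<Q : 2 ^ s' < Q
    2^s'<Q = ℕ.^-monoʳ-< 2 (s≤s (s≤s z≤n)) (ℕ.n<1+n s')
    K⇒T≡0 : ∀ {x} → x ∈ K-elements → T x ≡ 0#
    K⇒T≡0 {x} x∈ with ∈-filter⁻ K? {xs = elements} x∈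
    ... | x∈elements , x∈K with K⇒HasTrace x∈K
    ...   | inj₁ T≡0 = T≡0
    ...   | inj₂ T≡1 = ⊥-elim (none (Any.map (λ { refl → x∈K , T≡1 }) x∈elements))

  a₀ : Carrier
  a₀ = proj₁ T-onto

  a₀∈K : K a₀
  a₀∈K = proj₁ (proj₂ T-onto)

  Ta₀≡1 : HasTrace true a₀
  Ta₀≡1 = proj₂ (proj₂ T-onto)

  module TraceClasses (r : Carrier) (r∈K : K r) where

    Class : Bool → Bool → Pred Carrier 0ℓ
    Class a b = (K ∩ HasTrace a) ∩ (λ x → HasTrace b (x · r))

    Class? : ∀ a b → Decidable (Class a b)
    Class? a b = (K? ∩? HasTrace? a) ∩? (λ x → HasTrace? b (x · r))

    N : Bool → Bool → ℕ
    N a b = count (Class? a b)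

    classes-sum : (N false false + N false true) + (N true false + N true true) ≡ Q
    classes-sum = begin
      (N false false + N false true) + (N true false + N true true)  ≡⟨ sym (cong₂ _+_ (split-by-r false) (split-by-r true)) ⟩
      count (K? ∩? HasTrace? false) + count (K? ∩? HasTrace? true)   ≡⟨ sym split-by-T ⟩
      count K?                                                       ≡⟨ |K|≡Q ⟩
      Q                                                              ∎
      where
      open ≡-Reasoning
      split-by-T : count K? ≡ count (K? ∩? HasTrace? false) + count (K? ∩? HasTrace? true)
      split-by-T = count-partition K? (HasTrace? false) (HasTrace? true) K⇒HasTrace (λ {x} → HasTrace-disjoint {x})
      split-by-r : ∀ a → count (K? ∩? HasTrace? a) ≡ N a false + N a true
      split-by-r a = count-partition (K? ∩? HasTrace? a) (λ x → HasTrace? false (x · r)) (λ x → HasTrace? true (x · r))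
                                     (λ (x∈K , _) → K⇒HasTrace (K-· x∈K r∈K)) (λ {x} → HasTrace-disjoint {x · r})

    Class-⊕ : ∀ {a b a' b' x y} → Class a b x → Class a' b' y → Class (a xor a') (b xor b') (x ⊕ y)
    Class-⊕ {a} {b} {a'} {b'} {x} {y} ((x∈K , Tx) , Txr) ((y∈K , Ty) , Tyr) =
      (K-⊕ x∈K y∈K , trans (T-⊕ x y) (trans (cong₂ _⊕_ Tx Ty) (embed-xor a a'))) ,
      trans (cong T (distribʳ r x y)) (trans (T-⊕ _ _) (trans (cong₂ _⊕_ Txr Tyr) (embed-xor b b')))

    N-inhabited : ∀ a b {c} → Class a b c → N a b ≡ N false false
    N-inhabited a b {c} c∈Class = count-≡-bijection (Class? a b) (Class? false false) (_⊕ c) (_⊕ c)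
      (λ x → [x⊕y]⊕y≡x x c) (λ x → [x⊕y]⊕y≡x x c)
      (λ x∈Class → subst₂ (λ a' b' → Class a' b' _) (xor-same a) (xor-same b)
                          (Class-⊕ {a} {b} {a} {b} x∈Class c∈Class))
      (λ y∈Class → Class-⊕ {false} {false} {a} {b} y∈Class c∈Class)

    N-empty : ∀ a b → (∀ x → ¬ Class a b x) → N a b ≡ 0
    N-empty a b = count-≡0 (Class? a b)

    a₀-class : ∃[ b ] Class true b a₀
    a₀-class = let (b , Ta₀r) = K⇒trace (K-· a₀∈K r∈K) in b , (a₀∈K , Ta₀≡1) , Ta₀r

    N-r≡0 : r ≡ 0# → ∀ a b → N a b ≡ δ b false * (Q / 2)
    N-r≡0 r≡0 = N≡
      where
      open ≡-Reasoning
      T[x·r]≡0 : ∀ x → HasTrace false (x · r)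
      T[x·r]≡0 x = trans (cong T (trans (cong (x ·_) r≡0) (zeroʳ x))) (traceSum-0# (suc s'))
      N-a1≡0 : ∀ a → N a true ≡ 0
      N-a1≡0 a = N-empty a true λ x (_ , Txr≡1) → HasTrace-disjoint {x · r} (T[x·r]≡0 x) Txr≡1
      N10≡N00 : N true false ≡ N false false
      N10≡N00 = N-inhabited true false
        (subst (λ b → Class true b a₀) (embed-injective {proj₁ a₀-class} {false} b≡0) (proj₂ a₀-class))
        where
        b≡0 : embed (proj₁ a₀-class) ≡ embed false
        b≡0 = trans (sym (proj₂ (proj₂ a₀-class))) (T[x·r]≡0 a₀)
      N00≡Q/2 : N false false ≡ Q / 2
      N00≡Q/2 = n+n≡m⇒n≡m/2 (begin
        N false false + N false false                                  ≡⟨ sym (cong₂ _+_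
          (trans (cong (N false false +_) (N-a1≡0 false)) (ℕ.+-identityʳ _))
          (trans (cong₂ _+_ N10≡N00 (N-a1≡0 true)) (ℕ.+-identityʳ _))) ⟩
        (N false false + N false true) + (N true false + N true true) ≡⟨ classes-sum ⟩
        Q                                                              ∎)
      N≡ : ∀ a b → N a b ≡ δ b false * (Q / 2)
      N≡ a true = N-a1≡0 a
      N≡ false false = trans N00≡Q/2 (sym (ℕ.*-identityˡ _))
      N≡ true false = trans N10≡N00 (N≡ false false)

    N-r≡1 : r ≡ 1# → ∀ a b → N a b ≡ δ b a * (Q / 2)
    N-r≡1 r≡1 = N≡
      where
      open ≡-Reasoning
      T[x·r]≡Tx : ∀ x → T (x · r) ≡ T x
      T[x·r]≡Tx x = cong T (trans (cong (x ·_) r≡1) (*-identityʳ x))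
      N-off-diagonal : ∀ a b → a ≢ b → N a b ≡ 0
      N-off-diagonal a b a≢b = N-empty a b λ x ((_ , Tx) , Txr) →
        a≢b (embed-injective {a} {b} (trans (sym Tx) (trans (sym (T[x·r]≡Tx x)) Txr)))
      N11≡N00 : N true true ≡ N false false
      N11≡N00 = N-inhabited true true ((a₀∈K , Ta₀≡1) , trans (T[x·r]≡Tx a₀) Ta₀≡1)
      N00≡Q/2 : N false false ≡ Q / 2
      N00≡Q/2 = n+n≡m⇒n≡m/2 (begin
        N false false + N false false                                  ≡⟨ sym (cong₂ _+_
          (trans (cong (N false false +_) (N-off-diagonal false true (λ ()))) (ℕ.+-identityʳ _))
          (cong₂ _+_ (N-off-diagonal true false (λ ())) N11≡N00)) ⟩
        (N false false + N false true) + (N true false + N true true) ≡⟨ classes-sum ⟩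
        Q                                                              ∎)
      N≡ : ∀ a b → N a b ≡ δ b a * (Q / 2)
      N≡ false false = trans N00≡Q/2 (sym (ℕ.*-identityˡ _))
      N≡ true true = trans N11≡N00 (N≡ false false)
      N≡ false true = N-off-diagonal false true (λ ())
      N≡ true false = N-off-diagonal true false (λ ())

    module _ (r≢0 : r ≢ 0#) (r≢1 : r ≢ 1#) where
      open import Algebra.Solver.Ring.NaturalCoefficients.Default (CommutativeRing.commutativeSemiring commutativeRing)

      private
        ρ : Carrier
        ρ = proj₁ (inverse r r≢0)
        rρ≡1 : r · ρ ≡ 1#
        rρ≡1 = proj₂ (inverse r r≢0)
        r⊕1≢0 : r ⊕ 1# ≢ 0#
        r⊕1≢0 r⊕1≡0 = r≢1 (x⊕y≡0⇒x≡y r⊕1≡0)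
        σ : Carrier
        σ = proj₁ (inverse (r ⊕ 1#) r⊕1≢0)
        [r⊕1]σ≡1 : (r ⊕ 1#) · σ ≡ 1#
        [r⊕1]σ≡1 = proj₂ (inverse (r ⊕ 1#) r⊕1≢0)
        u∈K : K (a₀ · σ)
        u∈K = K-· a₀∈K (K-inverse (K-⊕ r∈K K-1#) [r⊕1]σ≡1)

      a₀/r-class : ∃[ a ] Class a true (a₀ · ρ)
      a₀/r-class = proj₁ (K⇒trace v∈K) , (v∈K , proj₂ (K⇒trace v∈K)) , Tvr≡1
        where
        v∈K : K (a₀ · ρ)
        v∈K = K-· a₀∈K (K-inverse r∈K rρ≡1)
        regroup : ∀ a ρ r → (a · ρ) · r ≡ a · (r · ρ)
        regroup = solve 3 (λ a ρ r → (a :* ρ) :* r := a :* (r :* ρ)) refl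
        Tvr≡1 : HasTrace true ((a₀ · ρ) · r)
        Tvr≡1 = trans (cong T (trans (regroup a₀ ρ r) (trans (cong (a₀ ·_) rρ≡1) (*-identityʳ a₀)))) Ta₀≡1

      a₀/[r⊕1]-class : ∃[ a ] Class a (not a) (a₀ · σ)
      a₀/[r⊕1]-class = classify (K⇒trace u∈K) (K⇒trace (K-· u∈K r∈K))
        where
        regroup : ∀ a σ r → (a · σ) · r ⊕ a · σ ≡ a · ((r ⊕ 1#) · σ)
        regroup = solve 3 (λ a σ r → (a :* σ) :* r :+ a :* σ := a :* ((r :+ con 1) :* σ)) refl
        T[ur]⊕Tu≡1 : T ((a₀ · σ) · r) ⊕ T (a₀ · σ) ≡ 1#
        T[ur]⊕Tu≡1 = trans (sym (T-⊕ ((a₀ · σ) · r) (a₀ · σ)))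
          (trans (cong T (trans (regroup a₀ σ r) (trans (cong (a₀ ·_) [r⊕1]σ≡1) (*-identityʳ a₀)))) Ta₀≡1)
        classify : ∃[ a ] HasTrace a (a₀ · σ) → ∃[ b ] HasTrace b ((a₀ · σ) · r) → ∃[ a ] Class a (not a) (a₀ · σ)
        classify (a , Tu) (b , Tur) =
          a , (u∈K , Tu) , subst (λ b → HasTrace b ((a₀ · σ) · r)) (xor≡true⇒≡not {b} {a} b⊕a≡1) Tur
          where
          b⊕a≡1 : b xor a ≡ true
          b⊕a≡1 = embed-injective {b xor a} {true}
            (trans (sym (embed-xor b a)) (trans (cong₂ _⊕_ (sym Tur) (sym Tu)) T[ur]⊕Tu≡1))

      all-classes-inhabited : ∀ a b → ∃ (Class a b)
      all-classes-inhabited = xor-closed-full (λ a b → ∃ (Class a b))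
        (λ {a} {b} {a'} {b'} (x , x∈) (y , y∈) → x ⊕ y , Class-⊕ {a} {b} {a'} {b'} x∈ y∈)
        (let (b , a₀∈) = a₀-class in b , a₀ , a₀∈)
        (let (a , v∈) = a₀/r-class in a , _ , v∈)
        (let (a , u∈) = a₀/[r⊕1]-class in a , _ , u∈)

      N-generic : ∀ a b → N a b ≡ Q / 4
      N-generic a b = trans (N≡N00 a b) ([n+n]+[n+n]≡m⇒n≡m/4 (begin
        (N false false + N false false) + (N false false + N false false) ≡⟨ sym (cong₂ _+_
          (cong₂ _+_ (N≡N00 false false) (N≡N00 false true)) (cong₂ _+_ (N≡N00 true false) (N≡N00 true true))) ⟩
        (N false false + N false true) + (N true false + N true true)     ≡⟨ classes-sum ⟩
        Q                                                                  ∎))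
        where
        open ≡-Reasoning
        N≡N00 : ∀ a b → N a b ≡ N false false
        N≡N00 a b = N-inhabited a b (proj₂ (all-classes-inhabited a b))

  module _ {lam : Carrier} (lam≢0 : lam ≢ 0#) where
    open TraceClasses (relTrace lam) (relTrace-K lam)

    private
      μ : Carrier
      μ = proj₁ (inverse lam lam≢0)
      lam·μ≡1 : lam · μ ≡ 1#
      lam·μ≡1 = proj₂ (inverse lam lam≢0)

    Scaled : Bool → Bool → Pred Carrier 0ℓ
    Scaled e i t = InS F (suc s') i t × TrQ2 F (suc s') (t · lam) ≡ embed e

    Scaled? : ∀ e i → Decidable (Scaled e i)
    Scaled? e i t = InS? F (suc s') i t ×-dec (TrQ2 F (suc s') (t · lam) ≟ embed e)

    countTS≡count-Scaled : ∀ e i → countTS F (suc s') e i lam ≡ count (Scaled? e i)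
    countTS≡count-Scaled e i = count-≡-bijection _ (Scaled? e i) (_· μ) (_· lam) [y·μ]·lam≡y [t·lam]·μ≡t to from
      where
      [t·lam]·μ≡t : ∀ t → (t · lam) · μ ≡ t
      [t·lam]·μ≡t t = trans (*-assoc t lam μ) (trans (cong (t ·_) lam·μ≡1) (*-identityʳ t))
      [y·μ]·lam≡y : ∀ y → (y · μ) · lam ≡ y
      [y·μ]·lam≡y y = trans (*-assoc y μ lam) (trans (cong (y ·_) (trans (*-comm μ lam) lam·μ≡1)) (*-identityʳ y))
      to : ∀ {y} → InT F (suc s') e y × InSλ F (suc s') i lam y → Scaled e i (y · μ)
      to (Tr≡e , y∈S·lam) with Any.satisfied y∈S·lam
      ... | t , t∈S , refl = subst (Scaled e i) (sym ([t·lam]·μ≡t t)) (t∈S , Tr≡e)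
      from : ∀ {t} → Scaled e i t → InT F (suc s') e (t · lam) × InSλ F (suc s') i lam (t · lam)
      from {t} (t∈S , Tr≡e) = Tr≡e , Any.map (λ { refl → t∈S , refl }) (complete t)

    count-Scaled≡N : ∀ e i → count (Scaled? e i) ≡ N i e
    count-Scaled≡N e i = count-cong (Scaled? e i) (Class? i e)
      (λ (t∈S , Tr≡e) → let t∈C = InS⇒Class i t∈S in t∈C , trans (sym (TrQ2≡T·r (proj₁ t∈C))) Tr≡e)
      (λ (t∈C , Tr≡e) → Class⇒InS i t∈C , trans (TrQ2≡T·r (proj₁ t∈C)) Tr≡e)
      where
      TrQ2≡T·r : ∀ {t} → K t → TrQ2 F (suc s') (t · lam) ≡ T (t · relTrace lam)
      TrQ2≡T·r {t} t∈K = trans (TrQ2≡T∘relTrace (t · lam)) (cong T (relTrace-K-· lam t∈K))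

    countTS≡N : ∀ e i → countTS F (suc s') e i lam ≡ N i e
    countTS≡N e i = trans (countTS≡count-Scaled e i) (count-Scaled≡N e i)

    countTS-G₀ : relTrace lam ≡ 0# → ∀ e i → countTS F (suc s') e i lam ≡ δ e false * (Q / 2)
    countTS-G₀ G₀ e i = trans (countTS≡N e i) (N-r≡0 G₀ i e)

    countTS-G₁ : relTrace lam ≡ 1# → ∀ e i → countTS F (suc s') e i lam ≡ δ e i * (Q / 2)
    countTS-G₁ G₁ e i = trans (countTS≡N e i) (N-r≡1 G₁ i e)

    countTS-Gᵣ : ∀ {r} → r ≢ 0# → r ≢ 1# → relTrace lam ≡ r → ∀ e i → countTS F (suc s') e i lam ≡ Q / 4
    countTS-Gᵣ r≢0 r≢1 refl e i = trans (countTS≡N e i) (N-generic r≢0 r≢1 i e)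

mainTheorem19 : (F : FiniteField) (s : ℕ) →
    FiniteField.card F ≡ q F s * q F s →
    (i e : Bool) (lam : FiniteField.Carrier F) → lam ≢ FiniteField.0# F →
    ((InG F s (FiniteField.0# F) lam → countTS F s e i lam ≡ δ e false * (q F s / 2))
    × (InG F s (FiniteField.1# F) lam → countTS F s e i lam ≡ δ e i * (q F s / 2))
    × ((r : FiniteField.Carrier F) → r ≢ FiniteField.0# F → r ≢ FiniteField.1# F →
        InG F s r lam → countTS F s e i lam ≡ q F s / 4))
mainTheorem19 F zero card≡1 _ _ _ _ =
  ⊥-elim (ℕ.<⇒≱ (ℕ.n<1+n 1) (subst (2 ≤_) card≡1 (FieldProperties.2≤card F)))
mainTheorem19 F (suc s') card≡q² i e lam lam≢0 =
  (λ G₀ → countTS-G₀ lam≢0 G₀ e i) ,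
  (λ G₁ → countTS-G₁ lam≢0 G₁ e i) ,
  (λ r r≢0 r≢1 Gᵣ → countTS-Gᵣ lam≢0 r≢0 r≢1 Gᵣ e i)
  where open SquareOrderField F s' card≡q²
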